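{- Consider the system $\mathsf{IL}+\mathsf{HMP}$ described below. (1) If $\vdash t : \exists\alpha\, A$ is derivable in $\mathsf{IL}+\mathsf{HMP}$ (empty context) and $t$ is in normal form, then $t=(m,u)$ for some first-order term $m$ and proof term $u$, and $\vdash u : A[m/\alpha]$ is derivable in $\mathsf{IL}+\mathsf{HMP}$. (2) If $\vdash t : A\lor B$ is derivable in $\mathsf{IL}+\mathsf{HMP}$ (empty context) and $t$ is in normal form, then either $t=\iota_0(u)$ and $\vdash u:A$ is derivable in $\mathsf{IL}+\mathsf{HMP}$, or $t=\iota_1(u)$ and $\vdash u:B$ is derivable in $\mathsf{IL}+\mathsf{HMP}$.
   Context: Fix a first-order language $\mathcal{L}$; formulas are built from atomic formulas and $\bot$ with $\land,\lor,\rightarrow,\forall,\exists$, with $\lnot A:=A\rightarrow\bot$; a propositional formula is a quantifier-free one. Proof terms: $t,u,v ::= x \mid tu \mid tm \mid \lambda x.u \mid \lambda\alpha.u \mid \langle t,u\rangle \mid \pi_0 u \mid \pi_1 u \mid \iota_0(u)\mid \iota_1(u) \mid t[x.u,y.v] \mid (m,t) \mid t[(\alpha,x).u] \mid \mathsf{H}_0^{\bot\rightarrow P} \mid \mathsf{MP}_P$, where $m$ ranges over terms of $\mathcal{L}$, $x,y$ over proof variables, $\alpha$ over first-order variables. Judgments $\Gamma\vdash t:A$ with $\Gamma=x_1:A_1,\dots,x_n:A_n$ (distinct variables) are generated by: $\Gamma,x:A\vdash x:A$; $\Gamma\vdash \mathsf{MP}_P:\lnot\lnot\exists\alpha\,P\rightarrow\exists\alpha\,P$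 for every propositional $P$ in which $\rightarrow$ does not occur; $\Gamma\vdash \mathsf{H}_0^{\bot\rightarrow P}:\bot\rightarrow P$; from $u:A$ and $t:B$ infer $\langle u,t\rangle:A\land B$; from $u:A\land B$ infer $\pi_0u:A$, $\pi_1u:B$; from $t:A\rightarrow B$ and $u:A$ infer $tu:B$; from $\Gamma,x:A\vdash u:B$ infer $\lambda x.u:A\rightarrow B$; from $u:A$ infer $\iota_0(u):A\lor B$, from $u:B$ infer $\iota_1(u):A\lor B$; from $u:A\lor B$, $\Gamma,x:A\vdash w_1:C$, $\Gamma,y:B\vdash w_2:C$ infer $u[x.w_1,y.w_2]:C$; from $u:\forall\alpha A$ infer $um:A[m/\alpha]$; from $u:A$ infer $\lambda\alpha.u:\forall\alpha A$ if $\alpha$ is not free in $\Gamma$; from $u:A[m/\alpha]$ infer $(m,u):\exists\alpha A$; from $u:\exists\alpha A$ and $\Gamma,x:A\vdash t:C$ infer $u[(\alpha,x).t]:C$ if $\alpha$ is not free in $C$ nor in $\Gamma$. Reduction rules (applicable to any subterm): $(\lambda x.u)t\mapsto u[t/x]$; $(\lambda\alpha.u)m\mapsto u[m/\alpha]$; $\pi_i\langle u_0,u_1\rangle\mapsto u_i$; $\iota_i(u)[x_0.t_0,x_1.t_1]\mapsto t_i[u/x_i]$; $(m,u)[(\alpha,x).v]\mapsto v[m/\alpha][u/x]$. The constants $\mathsf{MP}_P$ and $\mathsf{H}_0^{\bot\rightarrow P}$ have no reduction rules. A term is in normal form if none of its subterms is a redex. -}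

module Defs where

open import Data.Nat using (ℕ; zero; suc)
open import Data.Vec using (Vec; []; _∷_)
open import Data.List using (List; []; _∷_; map)
open import Data.Product using (_×_)
open import Data.Empty using (⊥)
open import Data.Unit using (⊤)
open import Relation.Nullary using (¬_)

record Language : Set₁ where
  field
    Fun      : Set
    funArity : Fun → ℕ
    Pred     : Set
    predArity : Pred → ℕ

module _ (L : Language) where
  open Language L

  data Tm : Set where
    var : ℕ → Tm
    fun : (f : Fun) → Vec Tm (funArity f) → Tm

  -- Formulas: atoms, ⊥, ∧, ∨, →, ∀, ∃  (∀ and ∃ bind de Bruijn index 0)

  data Fm : Set where
    atom : (p : Pred) → Vec Tm (predArity p) → Fm
    ⊥̇    : Fm
    _∧̇_  : Fm → Fm → Fm
    _∨̇_  : Fm → Fm → Fm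
    _⇒_  : Fm → Fm → Fm
    ∀̇    : Fm → Fm
    ∃̇    : Fm → Fm

  ¬̇_ : Fm → Fm
  ¬̇ A = A ⇒ ⊥̇

  NoImpProp : Fm → Set
  NoImpProp (atom p ts) = ⊤
  NoImpProp ⊥̇ = ⊤
  NoImpProp (A ∧̇ B) = NoImpProp A × NoImpProp B
  NoImpProp (A ∨̇ B) = NoImpProp A × NoImpProp B
  NoImpProp (A ⇒ B) = ⊥
  NoImpProp (∀̇ A) = ⊥
  NoImpProp (∃̇ A) = ⊥

  ext : (ℕ → ℕ) → ℕ → ℕ
  ext ρ zero = zero
  ext ρ (suc n) = suc (ρ n)

  mutual
    renTm : (ℕ → ℕ) → Tm → Tm
    renTm ρ (var n) = var (ρ n)
    renTm ρ (fun f ts) = fun f (renTms ρ ts)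

    renTms : ∀ {k} → (ℕ → ℕ) → Vec Tm k → Vec Tm k
    renTms ρ [] = []
    renTms ρ (t ∷ ts) = renTm ρ t ∷ renTms ρ ts

  exts : (ℕ → Tm) → ℕ → Tm
  exts σ zero = var zero
  exts σ (suc n) = renTm suc (σ n)

  mutual
    subTm : (ℕ → Tm) → Tm → Tm
    subTm σ (var n) = σ n
    subTm σ (fun f ts) = fun f (subTms σ ts)

    subTms : ∀ {k} → (ℕ → Tm) → Vec Tm k → Vec Tm k
    subTms σ [] = []
    subTms σ (t ∷ ts) = subTm σ t ∷ subTms σ ts

  subFm : (ℕ → Tm) → Fm → Fm
  subFm σ (atom p ts) = atom p (subTms σ ts)
  subFm σ ⊥̇ = ⊥̇
  subFm σ (A ∧̇ B) = subFm σ A ∧̇ subFm σ B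
  subFm σ (A ∨̇ B) = subFm σ A ∨̇ subFm σ B
  subFm σ (A ⇒ B) = subFm σ A ⇒ subFm σ B
  subFm σ (∀̇ A) = ∀̇ (subFm (exts σ) A)
  subFm σ (∃̇ A) = ∃̇ (subFm (exts σ) A)

  shiftFm : Fm → Fm
  shiftFm = subFm (λ n → var (suc n))

  single : Tm → ℕ → Tm
  single m zero = m
  single m (suc n) = var n

  _[_] : Fm → Tm → Fm
  A [ m ] = subFm (single m) A

  -- Proof variables are de Bruijn indices; `lam`, the two
  -- branches of `case` and `exE` bind one proof variable (index 0);
  -- `Lam` and `exE` bind one first-order variable (index 0).

  data PT : Set where
    pvar : ℕ → PT
    app  : PT → PT → PT
    appT : PT → Tm → PT
    lam  : PT → PT
    Lam  : PT → PT
    pair : PT → PT → PT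
    π₀ π₁ : PT → PT
    ι₀ ι₁ : PT → PT
    case : PT → PT → PT → PT
    ex   : Tm → PT → PT
    exE  : PT → PT → PT
    H₀   : Fm → PT
    MP   : Fm → PT                 -- MP_P  (P under the binder of ∃α P)

  Ctx : Set
  Ctx = List Fm

  data _∋_∶_ : Ctx → ℕ → Fm → Set where
    here  : ∀ {Γ A} → (A ∷ Γ) ∋ zero ∶ A
    there : ∀ {Γ A B n} → Γ ∋ n ∶ A → (B ∷ Γ) ∋ suc n ∶ A

  shiftCtx : Ctx → Ctx
  shiftCtx = map shiftFm

  data _⊢_∶_ : Ctx → PT → Fm → Set where
    ax    : ∀ {Γ n A} → Γ ∋ n ∶ A → Γ ⊢ pvar n ∶ A
    mpAx  : ∀ {Γ P} → NoImpProp P →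
            Γ ⊢ MP P ∶ ((¬̇ (¬̇ (∃̇ P))) ⇒ ∃̇ P)
    efq   : ∀ {Γ P} → Γ ⊢ H₀ P ∶ (⊥̇ ⇒ P)
    ∧I    : ∀ {Γ u t A B} → Γ ⊢ u ∶ A → Γ ⊢ t ∶ B → Γ ⊢ pair u t ∶ (A ∧̇ B)
    ∧E₀   : ∀ {Γ u A B} → Γ ⊢ u ∶ (A ∧̇ B) → Γ ⊢ π₀ u ∶ A
    ∧E₁   : ∀ {Γ u A B} → Γ ⊢ u ∶ (A ∧̇ B) → Γ ⊢ π₁ u ∶ B
    ⇒E    : ∀ {Γ t u A B} → Γ ⊢ t ∶ (A ⇒ B) → Γ ⊢ u ∶ A → Γ ⊢ app t u ∶ B
    ⇒I    : ∀ {Γ u A B} → (A ∷ Γ) ⊢ u ∶ B → Γ ⊢ lam u ∶ (A ⇒ B)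
    ∨I₀   : ∀ {Γ u A B} → Γ ⊢ u ∶ A → Γ ⊢ ι₀ u ∶ (A ∨̇ B)
    ∨I₁   : ∀ {Γ u A B} → Γ ⊢ u ∶ B → Γ ⊢ ι₁ u ∶ (A ∨̇ B)
    ∨E    : ∀ {Γ u w₁ w₂ A B C} → Γ ⊢ u ∶ (A ∨̇ B) →
            (A ∷ Γ) ⊢ w₁ ∶ C → (B ∷ Γ) ⊢ w₂ ∶ C → Γ ⊢ case u w₁ w₂ ∶ C
    ∀E    : ∀ {Γ u A} (m : Tm) → Γ ⊢ u ∶ ∀̇ A → Γ ⊢ appT u m ∶ (A [ m ])
    -- eigenvariable condition: u is typed in the context weakened by α
    ∀I    : ∀ {Γ u A} → shiftCtx Γ ⊢ u ∶ A → Γ ⊢ Lam u ∶ ∀̇ A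
    ∃I    : ∀ {Γ u A} (m : Tm) → Γ ⊢ u ∶ (A [ m ]) → Γ ⊢ ex m u ∶ ∃̇ A
    -- eigenvariable condition: α not free in C nor Γ (via weakening)
    ∃E    : ∀ {Γ u t A C} → Γ ⊢ u ∶ ∃̇ A →
            (A ∷ shiftCtx Γ) ⊢ t ∶ shiftFm C → Γ ⊢ exE u t ∶ C

  Redex : PT → Set
  Redex (app (lam u) t) = ⊤
  Redex (appT (Lam u) m) = ⊤
  Redex (π₀ (pair u₀ u₁)) = ⊤
  Redex (π₁ (pair u₀ u₁)) = ⊤
  Redex (case (ι₀ u) t₀ t₁) = ⊤
  Redex (case (ι₁ u) t₀ t₁) = ⊤
  Redex (exE (ex m u) v) = ⊤
  Redex _ = ⊥

  Normal : PT → Set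
  Normal t = ¬ Redex t × NormalSubs t
    where
    NormalSubs : PT → Set
    NormalSubs (pvar n) = ⊤
    NormalSubs (app t u) = Normal t × Normal u
    NormalSubs (appT t m) = Normal t
    NormalSubs (lam u) = Normal u
    NormalSubs (Lam u) = Normal u
    NormalSubs (pair t u) = Normal t × Normal u
    NormalSubs (π₀ u) = Normal u
    NormalSubs (π₁ u) = Normal u
    NormalSubs (ι₀ u) = Normal u
    NormalSubs (ι₁ u) = Normal u
    NormalSubs (case t u v) = Normal t × Normal u × Normal v
    NormalSubs (ex m t) = Normal t
    NormalSubs (exE t u) = Normal t × Normal u
    NormalSubs (H₀ P) = ⊤
    NormalSubs (MP P) = ⊤

-- Interpret formulas in the one-point model in which every atom is false. Closed
-- derivations are sound for it, and there neither ⊥ nor ¬¬∃P (for →-free P) holds,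
-- so no closed term inhabits them. Hence the head of a closed normal term can be
-- neither an elimination (its major premise would itself be canonical, giving a
-- redex) nor an application of H₀ or MP (whose argument would be such a closed term):
-- it is an introduction or a constant, and its type fixes which one.
module Submission where

open import Defs
open import Data.List using ([]; _∷_)
open import Data.List.Relation.Unary.All as All using (All; []; _∷_)
open import Data.List.Relation.Unary.All.Properties using (map⁺)
open import Data.Product using (Σ; _×_; _,_; proj₁; proj₂)
open import Data.Sum using (_⊎_; inj₁; inj₂)
open import Data.Empty using (⊥; ⊥-elim)
open import Data.Unit using (tt)
open import Function using (id)
open import Relation.Nullary using (¬_)
open import Relation.Binary.PropositionalEquality using (_≡_; refl; subst; sym; cong₂)

module _ (L : Language) where

  ⟦_⟧ : Fm L → Set
  ⟦ atom p ts ⟧ = ⊥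
  ⟦ ⊥̇ ⟧ = ⊥
  ⟦ A ∧̇ B ⟧ = ⟦ A ⟧ × ⟦ B ⟧
  ⟦ A ∨̇ B ⟧ = ⟦ A ⟧ ⊎ ⟦ B ⟧
  ⟦ A ⇒ B ⟧ = ⟦ A ⟧ → ⟦ B ⟧
  ⟦ ∀̇ A ⟧ = ⟦ A ⟧
  ⟦ ∃̇ A ⟧ = ⟦ A ⟧

  ⟦subFm⟧ : ∀ σ A → ⟦ subFm L σ A ⟧ ≡ ⟦ A ⟧
  ⟦subFm⟧ σ (atom p ts) = refl
  ⟦subFm⟧ σ ⊥̇ = refl
  ⟦subFm⟧ σ (A ∧̇ B) = cong₂ _×_ (⟦subFm⟧ σ A) (⟦subFm⟧ σ B)
  ⟦subFm⟧ σ (A ∨̇ B) = cong₂ _⊎_ (⟦subFm⟧ σ A) (⟦subFm⟧ σ B)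
  ⟦subFm⟧ σ (A ⇒ B) = cong₂ (λ X Y → X → Y) (⟦subFm⟧ σ A) (⟦subFm⟧ σ B)
  ⟦subFm⟧ σ (∀̇ A) = ⟦subFm⟧ (exts L σ) A
  ⟦subFm⟧ σ (∃̇ A) = ⟦subFm⟧ (exts L σ) A

  ⟦subFm⟧⁺ : ∀ σ A → ⟦ A ⟧ → ⟦ subFm L σ A ⟧
  ⟦subFm⟧⁺ σ A = subst id (sym (⟦subFm⟧ σ A))

  ⟦subFm⟧⁻ : ∀ σ A → ⟦ subFm L σ A ⟧ → ⟦ A ⟧
  ⟦subFm⟧⁻ σ A = subst id (⟦subFm⟧ σ A)

  NoImpProp⇒¬⟦⟧ : ∀ P → NoImpProp L P → ¬ ⟦ P ⟧
  NoImpProp⇒¬⟦⟧ (A ∧̇ B) (a , b) (x , y) = NoImpProp⇒¬⟦⟧ A a x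
  NoImpProp⇒¬⟦⟧ (A ∨̇ B) (a , b) (inj₁ x) = NoImpProp⇒¬⟦⟧ A a x
  NoImpProp⇒¬⟦⟧ (A ∨̇ B) (a , b) (inj₂ y) = NoImpProp⇒¬⟦⟧ B b y

  lookup-∋ : ∀ {Γ n A} → _∋_∶_ L Γ n A → All ⟦_⟧ Γ → ⟦ A ⟧
  lookup-∋ here (x ∷ ρ) = x
  lookup-∋ (there i) (x ∷ ρ) = lookup-∋ i ρ

  All⟦⟧-shiftCtx : ∀ {Γ} → All ⟦_⟧ Γ → All ⟦_⟧ (shiftCtx L Γ)
  All⟦⟧-shiftCtx ρ = map⁺ (All.map (λ {A} → ⟦subFm⟧⁺ _ A) ρ)

  ⊢-sound : ∀ {Γ t A} → _⊢_∶_ L Γ t A → All ⟦_⟧ Γ → ⟦ A ⟧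
  ⊢-sound (ax i) ρ = lookup-∋ i ρ
  ⊢-sound (mpAx {P = P} p) ρ ¬¬P = ⊥-elim (¬¬P (NoImpProp⇒¬⟦⟧ P p))
  ⊢-sound efq ρ ()
  ⊢-sound (∧I d e) ρ = ⊢-sound d ρ , ⊢-sound e ρ
  ⊢-sound (∧E₀ d) ρ = proj₁ (⊢-sound d ρ)
  ⊢-sound (∧E₁ d) ρ = proj₂ (⊢-sound d ρ)
  ⊢-sound (⇒E d e) ρ = ⊢-sound d ρ (⊢-sound e ρ)
  ⊢-sound (⇒I d) ρ = λ x → ⊢-sound d (x ∷ ρ)
  ⊢-sound (∨I₀ d) ρ = inj₁ (⊢-sound d ρ)
  ⊢-sound (∨I₁ d) ρ = inj₂ (⊢-sound d ρ)
  ⊢-sound (∨E d e f) ρ with ⊢-sound d ρ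
  ... | inj₁ x = ⊢-sound e (x ∷ ρ)
  ... | inj₂ y = ⊢-sound f (y ∷ ρ)
  ⊢-sound (∀E {A = A} m d) ρ = ⟦subFm⟧⁺ (single L m) A (⊢-sound d ρ)
  ⊢-sound (∀I d) ρ = ⊢-sound d (All⟦⟧-shiftCtx ρ)
  ⊢-sound (∃I {A = A} m d) ρ = ⟦subFm⟧⁻ (single L m) A (⊢-sound d ρ)
  ⊢-sound (∃E {C = C} d e) ρ =
    ⟦subFm⟧⁻ _ C (⊢-sound e (⊢-sound d ρ ∷ All⟦⟧-shiftCtx ρ))

  closed-⊬⊥ : ∀ {t} → ¬ _⊢_∶_ L [] t ⊥̇
  closed-⊬⊥ d = ⊢-sound d []

  closed-⊬¬¬∃ : ∀ {t P} → NoImpProp L P → ¬ _⊢_∶_ L [] t (¬̇_ L (¬̇_ L (∃̇ P)))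
  closed-⊬¬¬∃ {P = P} p d = ⊢-sound d [] (NoImpProp⇒¬⟦⟧ P p)

  data Canonical : PT L → Fm L → Set where
    lam  : ∀ {u A B} → Canonical (lam u) (A ⇒ B)
    Lam  : ∀ {u A} → Canonical (Lam u) (∀̇ A)
    pair : ∀ {u v A B} → Canonical (pair u v) (A ∧̇ B)
    ι₀   : ∀ {u A B} → _⊢_∶_ L [] u A → Canonical (ι₀ u) (A ∨̇ B)
    ι₁   : ∀ {u A B} → _⊢_∶_ L [] u B → Canonical (ι₁ u) (A ∨̇ B)
    ex   : ∀ {m u A} → _⊢_∶_ L [] u (_[_] L A m) → Canonical (ex m u) (∃̇ A)
    H₀   : ∀ {P} → Canonical (H₀ P) (⊥̇ ⇒ P)
    MP   : ∀ {P} → NoImpProp L P → Canonical (MP P) (¬̇_ L (¬̇_ L (∃̇ P)) ⇒ ∃̇ P)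

  closed-normal⇒canonical : ∀ {t C} → _⊢_∶_ L [] t C → Normal L t → Canonical t C
  closed-normal⇒canonical (ax ()) _
  closed-normal⇒canonical (mpAx p) _ = MP p
  closed-normal⇒canonical efq _ = H₀
  closed-normal⇒canonical (∧I _ _) _ = pair
  closed-normal⇒canonical (⇒I _) _ = lam
  closed-normal⇒canonical (∨I₀ d) _ = ι₀ d
  closed-normal⇒canonical (∨I₁ d) _ = ι₁ d
  closed-normal⇒canonical (∀I _) _ = Lam
  closed-normal⇒canonical (∃I _ d) _ = ex d
  closed-normal⇒canonical (∧E₀ d) (¬redex , nf) with closed-normal⇒canonical d nf
  ... | pair = ⊥-elim (¬redex tt)
  closed-normal⇒canonical (∧E₁ d) (¬redex , nf) with closed-normal⇒canonical d nf
  ... | pair = ⊥-elim (¬redex tt)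
  closed-normal⇒canonical (⇒E d e) (¬redex , nf , _) with closed-normal⇒canonical d nf
  ... | lam = ⊥-elim (¬redex tt)
  ... | H₀ = ⊥-elim (closed-⊬⊥ e)
  ... | MP p = ⊥-elim (closed-⊬¬¬∃ p e)
  closed-normal⇒canonical (∨E d _ _) (¬redex , nf , _) with closed-normal⇒canonical d nf
  ... | ι₀ _ = ⊥-elim (¬redex tt)
  ... | ι₁ _ = ⊥-elim (¬redex tt)
  closed-normal⇒canonical (∀E _ d) (¬redex , nf) with closed-normal⇒canonical d nf
  ... | Lam = ⊥-elim (¬redex tt)
  closed-normal⇒canonical (∃E d _) (¬redex , nf , _) with closed-normal⇒canonical d nf
  ... | ex _ = ⊥-elim (¬redex tt)

theorem2p4 : (L : Language) →
    ((t : PT L) (A : Fm L) → _⊢_∶_ L [] t (∃̇ A) → Normal L t →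
      Σ (Tm L) (λ m → Σ (PT L) (λ u → (t ≡ ex m u) × _⊢_∶_ L [] u (_[_] L A m))))
    × ((t : PT L) (A B : Fm L) → _⊢_∶_ L [] t (A ∨̇ B) → Normal L t →
      (Σ (PT L) (λ u → (t ≡ ι₀ u) × _⊢_∶_ L [] u A))
      ⊎ (Σ (PT L) (λ u → (t ≡ ι₁ u) × _⊢_∶_ L [] u B)))
theorem2p4 L = existence , disjunction
  where
  existence : (t : PT L) (A : Fm L) → _⊢_∶_ L [] t (∃̇ A) → Normal L t →
    Σ (Tm L) (λ m → Σ (PT L) (λ u → (t ≡ ex m u) × _⊢_∶_ L [] u (_[_] L A m)))
  existence t A d nf with closed-normal⇒canonical L d nf
  ... | ex {m} {u} e = m , u , refl , e

  disjunction : (t : PT L) (A B : Fm L) → _⊢_∶_ L [] t (A ∨̇ B) → Normal L t →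
    (Σ (PT L) (λ u → (t ≡ ι₀ u) × _⊢_∶_ L [] u A))
    ⊎ (Σ (PT L) (λ u → (t ≡ ι₁ u) × _⊢_∶_ L [] u B))
  disjunction t A B d nf with closed-normal⇒canonical L d nf
  ... | ι₀ {u} e = inj₁ (u , refl , e)
  ... | ι₁ {u} e = inj₂ (u , refl , e)
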